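{- Let $G$ and $H$ be two connected graphs of order $n_1\ge 2$ and $n_2$, respectively. Then $$\dim(G\boxtimes H)\le n_1\cdot \dim(H)+n_2\cdot \dim(G)-\dim(G)\cdot \dim(H).$$
   Context: All graphs are simple and connected; $d_G(x,y)$ denotes the length of a shortest $x$–$y$ path in $G$. A vertex $v$ distinguishes vertices $x,y$ if $d_G(v,x)\ne d_G(v,y)$. A set $S\subseteq V(G)$ is a metric generator for $G$ if every pair of distinct vertices of $G$ is distinguished by some element of $S$; the metric dimension $\dim(G)$ is the minimum cardinality of a metric generator. The strong product $G\boxtimes H$ has vertex set $V(G)\times V(H)$, with $(a,b)$ and $(c,d)$ adjacent iff ($a=c$ and $bd\in E(H)$) or ($b=d$ and $ac\in E(G)$) or ($ac\in E(G)$ and $bd\in E(H)$). -}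

module Defs where

open import Level using (0ℓ)
open import Data.Nat using (ℕ; zero; suc; _*_; _≤_)
open import Data.Fin using (Fin; remQuot)
open import Data.Fin.Subset using (Subset; _∈_; ∣_∣)
open import Data.Product using (Σ; ∃; _×_; _,_; proj₁; proj₂)
open import Data.Sum using (_⊎_; inj₁; inj₂)
open import Relation.Nullary using (¬_)
open import Relation.Binary.PropositionalEquality using (_≡_; _≢_; refl; sym; cong)

record Graph : Set₁ where
  field
    order : ℕ
    Adj   : Fin order → Fin order → Set
    sym-Adj   : ∀ {x y} → Adj x y → Adj y x
    irrefl-Adj : ∀ {x} → ¬ Adj x x
open Graph public

data Walk (G : Graph) : Fin (order G) → Fin (order G) → ℕ → Set where
  []  : ∀ {x} → Walk G x x 0
  _∷_ : ∀ {x y z k} → Adj G x y → Walk G y z k → Walk G x z (suc k)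

Connected : Graph → Set
Connected G = Fin (order G) × (∀ x y → ∃ λ k → Walk G x y k)

Dist : (G : Graph) → Fin (order G) → Fin (order G) → ℕ → Set
Dist G x y k = Walk G x y k × (∀ j → Walk G x y j → k ≤ j)

Distinguishes : (G : Graph) → Fin (order G) → Fin (order G) → Fin (order G) → Set
Distinguishes G v x y = ∃ λ a → ∃ λ b → Dist G v x a × Dist G v y b × a ≢ b

IsMetricGenerator : (G : Graph) → Subset (order G) → Set
IsMetricGenerator G S =
  ∀ x y → x ≢ y → ∃ λ v → v ∈ S × Distinguishes G v x y

IsMetricDim : Graph → ℕ → Set
IsMetricDim G k =
  (∃ λ S → IsMetricGenerator G S × ∣ S ∣ ≡ k)
  × (∀ S → IsMetricGenerator G S → k ≤ ∣ S ∣)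

-- Strong product; vertex (a,b) ↔ combine a b, decoded via remQuot.
StrongAdj : (G H : Graph) → Fin (order G * order H) → Fin (order G * order H) → Set
StrongAdj G H p q with remQuot {order G} (order H) p | remQuot {order G} (order H) q
... | (a , b) | (c , d) =
  (a ≡ c × Adj H b d) ⊎ (b ≡ d × Adj G a c) ⊎ (Adj G a c × Adj H b d)

private
  strong-sym : (G H : Graph) → ∀ {p q} → StrongAdj G H p q → StrongAdj G H q p
  strong-sym G H {p} {q} e with remQuot {order G} (order H) p | remQuot {order G} (order H) q
  ... | (a , b) | (c , d) with e
  ... | inj₁ (eq , h) = inj₁ (sym eq , sym-Adj H h)
  ... | inj₂ (inj₁ (eq , g)) = inj₂ (inj₁ (sym eq , sym-Adj G g))
  ... | inj₂ (inj₂ (g , h)) = inj₂ (inj₂ (sym-Adj G g , sym-Adj H h))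

  strong-irrefl : (G H : Graph) → ∀ {p} → ¬ StrongAdj G H p p
  strong-irrefl G H {p} e with remQuot {order G} (order H) p
  ... | (a , b) with e
  ... | inj₁ (_ , h) = irrefl-Adj H h
  ... | inj₂ (inj₁ (_ , g)) = irrefl-Adj G g
  ... | inj₂ (inj₂ (g , _)) = irrefl-Adj G g

_⊠_ : Graph → Graph → Graph
G ⊠ H = record
  { order = order G * order H
  ; Adj = StrongAdj G H
  ; sym-Adj = strong-sym G H
  ; irrefl-Adj = strong-irrefl G H
  }

module Submission where

-- Distances in G ⊠ H are d((a , b) , (c , d)) = max (d_G(a , c)) (d_H(b , d)): a walk in the
-- product projects to walks in both factors that may pause at a vertex, and two such walks of
-- equal length zip into a walk in the product. Hence for metric generators SG and SH the set
-- (V(G) × SH) ∪ (SG × V(H)) is a metric generator of G ⊠ H, of size n₁|SH| + n₂|SG| − |SG||SH|.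
-- Adjacency is not decidable, so distances exist only classically; this suffices because the
-- inequality to be proved is decidable.

open import Defs
open import Data.Nat using (ℕ; suc; _+_; _*_; _⊔_; _≤_; _≥_; _<_; z≤n; s≤s; _≤?_)
open import Data.Nat.Properties
open import Data.Nat.Induction using (<-rec)
open import Data.Nat.Tactic.RingSolver using (solve-∀)
open import Data.Fin using (Fin; remQuot; combine)
open import Data.Fin.Properties using (remQuot-combine; combine-remQuot; sequence) renaming (_≟_ to _≟ᶠ_)
open import Data.Fin.Subset using (Subset; _∈_; ∣_∣; inside; ⊤)
open import Data.Fin.Subset.Properties using (∈⊤; ∣⊤∣≡n)
open import Data.Vec using ([]; _∷_; lookup; concat; _++_; map)
open import Data.Vec.Properties using (lookup-concat; lookup-map; []=⇒lookup; lookup⇒[]=)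
open import Data.Bool using (Bool; true; false)
open import Data.Product using (∃; _×_; _,_; proj₁; proj₂; uncurry)
open import Data.Sum using (_⊎_; inj₁; inj₂)
open import Effect.Monad using (RawMonad)
open import Level using (0ℓ)
open import Relation.Nullary using (yes; no)
open import Relation.Nullary.Decidable using (decidable-stable; ¬¬-excluded-middle)
open import Relation.Nullary.Negation using (DoubleNegation; ¬¬-Monad; contradiction)
open import Relation.Binary.PropositionalEquality

open RawMonad (¬¬-Monad {a = 0ℓ}) using (return; _>>=_; rawApplicative)

Least : (ℕ → Set) → Set
Least P = ∃ λ n → P n × ∀ j → P j → n ≤ j

¬¬-least : (P : ℕ → Set) → ∀ m → P m → DoubleNegation (Least P)
¬¬-least P = <-rec (λ m → P m → DoubleNegation (Least P)) least-below
  where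
  least-below : ∀ m → (∀ {k} → k < m → P k → DoubleNegation (Least P)) → P m → DoubleNegation (Least P)
  least-below m rec pm = ¬¬-excluded-middle {A = ∃ λ k → k < m × P k} >>= λ where
    (yes (k , k<m , pk)) → rec k<m pk
    (no none) → return (m , pm , λ j pj → ≮⇒≥ (λ j<m → none (j , j<m , pj)))

¬¬-Dist : (G : Graph) → Connected G → DoubleNegation (∀ x y → ∃ (Dist G x y))
¬¬-Dist G (_ , walk) =
  sequence rawApplicative {P = λ x → ∀ y → ∃ (Dist G x y)} λ x →
  sequence rawApplicative {P = λ y → ∃ (Dist G x y)} λ y →
  ¬¬-least (Walk G x y) (proj₁ (walk x y)) (proj₂ (walk x y))

data LazyWalk (G : Graph) : Fin (order G) → Fin (order G) → ℕ → Set where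
  []  : ∀ {x} → LazyWalk G x x 0
  _∷_ : ∀ {x y z k} → x ≡ y ⊎ Adj G x y → LazyWalk G y z k → LazyWalk G x z (suc k)

module _ {G : Graph} where

  walk⇒lazy : ∀ {x y k} → Walk G x y k → LazyWalk G x y k
  walk⇒lazy [] = []
  walk⇒lazy (e ∷ w) = inj₂ e ∷ walk⇒lazy w

  lazy⇒walk : ∀ {x y k} → LazyWalk G x y k → ∃ λ j → j ≤ k × Walk G x y j
  lazy⇒walk [] = 0 , z≤n , []
  lazy⇒walk (inj₁ refl ∷ w) with lazy⇒walk w
  ... | j , j≤k , w′ = j , m≤n⇒m≤1+n j≤k , w′
  lazy⇒walk (inj₂ e ∷ w) with lazy⇒walk w
  ... | j , j≤k , w′ = suc j , s≤s j≤k , e ∷ w′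

  lazy-pad : ∀ {x y k n} → k ≤ n → LazyWalk G x y k → LazyWalk G x y n
  lazy-pad {n = 0} z≤n [] = []
  lazy-pad {n = suc n} z≤n [] = inj₁ refl ∷ lazy-pad z≤n []
  lazy-pad (s≤s k≤n) (s ∷ w) = s ∷ lazy-pad k≤n w

  Dist-≤-lazy : ∀ {x y α k} → Dist G x y α → LazyWalk G x y k → α ≤ k
  Dist-≤-lazy (_ , shortest) w with lazy⇒walk w
  ... | j , j≤k , w′ = ≤-trans (shortest j w′) j≤k

  Dist-refl : ∀ x → Dist G x x 0
  Dist-refl x = [] , λ _ _ → z≤n

module _ {G H : Graph} where

  private
    π₁ : Fin (order G * order H) → Fin (order G)
    π₁ p = proj₁ (remQuot {order G} (order H) p)

    π₂ : Fin (order G * order H) → Fin (order H)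
    π₂ p = proj₂ (remQuot {order G} (order H) p)

    StrongCondition : Fin (order G) × Fin (order H) → Fin (order G) × Fin (order H) → Set
    StrongCondition (a , b) (c , d) = (a ≡ c × Adj H b d) ⊎ (b ≡ d × Adj G a c) ⊎ (Adj G a c × Adj H b d)

    StrongAdj-combine : ∀ {a b c d} → StrongCondition (a , b) (c , d) →
      Adj (G ⊠ H) (combine a b) (combine c d)
    StrongAdj-combine {a} {b} {c} {d} =
      subst₂ StrongCondition (sym (remQuot-combine a b)) (sym (remQuot-combine c d))

  ⊠-step : ∀ {a b c d} → a ≡ c ⊎ Adj G a c → b ≡ d ⊎ Adj H b d →
    combine a b ≡ combine c d ⊎ Adj (G ⊠ H) (combine a b) (combine c d)
  ⊠-step (inj₁ refl) (inj₁ refl) = inj₁ refl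
  ⊠-step (inj₁ refl) (inj₂ h) = inj₂ (StrongAdj-combine (inj₁ (refl , h)))
  ⊠-step (inj₂ g) (inj₁ refl) = inj₂ (StrongAdj-combine (inj₂ (inj₁ (refl , g))))
  ⊠-step (inj₂ g) (inj₂ h) = inj₂ (StrongAdj-combine (inj₂ (inj₂ (g , h))))

  ⊠-zip : ∀ {a b c d k} → LazyWalk G a c k → LazyWalk H b d k →
    LazyWalk (G ⊠ H) (combine a b) (combine c d) k
  ⊠-zip [] [] = []
  ⊠-zip (s ∷ v) (t ∷ w) = ⊠-step s t ∷ ⊠-zip v w

  ⊠-step-π₁ : ∀ {p q} → Adj (G ⊠ H) p q → π₁ p ≡ π₁ q ⊎ Adj G (π₁ p) (π₁ q)
  ⊠-step-π₁ {p} {q} e with remQuot {order G} (order H) p | remQuot {order G} (order H) q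
  ... | (a , b) | (c , d) with e
  ... | inj₁ (a≡c , _) = inj₁ a≡c
  ... | inj₂ (inj₁ (_ , g)) = inj₂ g
  ... | inj₂ (inj₂ (g , _)) = inj₂ g

  ⊠-step-π₂ : ∀ {p q} → Adj (G ⊠ H) p q → π₂ p ≡ π₂ q ⊎ Adj H (π₂ p) (π₂ q)
  ⊠-step-π₂ {p} {q} e with remQuot {order G} (order H) p | remQuot {order G} (order H) q
  ... | (a , b) | (c , d) with e
  ... | inj₁ (_ , h) = inj₂ h
  ... | inj₂ (inj₁ (b≡d , _)) = inj₁ b≡d
  ... | inj₂ (inj₂ (_ , h)) = inj₂ h

  ⊠-walk-π₁ : ∀ {p q k} → Walk (G ⊠ H) p q k → LazyWalk G (π₁ p) (π₁ q) k
  ⊠-walk-π₁ [] = []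
  ⊠-walk-π₁ (e ∷ w) = ⊠-step-π₁ e ∷ ⊠-walk-π₁ w

  ⊠-walk-π₂ : ∀ {p q k} → Walk (G ⊠ H) p q k → LazyWalk H (π₂ p) (π₂ q) k
  ⊠-walk-π₂ [] = []
  ⊠-walk-π₂ (e ∷ w) = ⊠-step-π₂ e ∷ ⊠-walk-π₂ w

  Dist-⊠ : ∀ {a b c d α β} → Dist G a c α → Dist H b d β →
    Dist (G ⊠ H) (combine a b) (combine c d) (α ⊔ β)
  Dist-⊠ {a} {b} {c} {d} {α} {β} dα@(wα , _) dβ@(wβ , _)
    with lazy⇒walk (⊠-zip (lazy-pad (m≤m⊔n α β) (walk⇒lazy wα)) (lazy-pad (m≤n⊔m α β) (walk⇒lazy wβ)))
  ... | j , j≤α⊔β , w = subst (Walk (G ⊠ H) _ _) (≤-antisym j≤α⊔β (α⊔β≤ j w)) w , α⊔β≤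
    where
    α⊔β≤ : ∀ k → Walk (G ⊠ H) (combine a b) (combine c d) k → α ⊔ β ≤ k
    α⊔β≤ k w = ⊔-lub
      (Dist-≤-lazy dα (subst₂ (λ x y → LazyWalk G x y k)
        (cong proj₁ (remQuot-combine a b)) (cong proj₁ (remQuot-combine c d)) (⊠-walk-π₁ w)))
      (Dist-≤-lazy dβ (subst₂ (λ x y → LazyWalk H x y k)
        (cong proj₂ (remQuot-combine a b)) (cong proj₂ (remQuot-combine c d)) (⊠-walk-π₂ w)))

row : ∀ {n} → Subset n → Bool → Subset n
row p true = ⊤
row p false = p

-- combine a b encodes the vertex (a , b), and lies in row a of the concatenation,
-- so this is the set (V(G) × SH) ∪ (SG × V(H)).
⊠-generator : ∀ {n₁ n₂} → Subset n₁ → Subset n₂ → Subset (n₁ * n₂)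
⊠-generator SG SH = concat (map (row SH) SG)

module _ {n₁ n₂} (SG : Subset n₁) (SH : Subset n₂) where

  combine-∈-⊠-generator : ∀ {a b} → b ∈ row SH (lookup SG a) → combine a b ∈ ⊠-generator SG SH
  combine-∈-⊠-generator {a} {b} b∈ = lookup⇒[]= _ (⊠-generator SG SH) (begin
    lookup (⊠-generator SG SH) (combine a b)  ≡⟨ lookup-concat (map (row SH) SG) a b ⟩
    lookup (lookup (map (row SH) SG) a) b     ≡⟨ cong (λ r → lookup r b) (lookup-map a (row SH) SG) ⟩
    lookup (row SH (lookup SG a)) b           ≡⟨ []=⇒lookup b∈ ⟩
    inside                                    ∎)
    where open ≡-Reasoning

  ∈-row : ∀ {b} bit → b ∈ SH → b ∈ row SH bit
  ∈-row true _ = ∈⊤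
  ∈-row false b∈ = b∈

  column-⊆-⊠-generator : ∀ {a b} → b ∈ SH → combine a b ∈ ⊠-generator SG SH
  column-⊆-⊠-generator {a} b∈ = combine-∈-⊠-generator (∈-row (lookup SG a) b∈)

  row-⊆-⊠-generator : ∀ {a b} → a ∈ SG → combine a b ∈ ⊠-generator SG SH
  row-⊆-⊠-generator a∈ = combine-∈-⊠-generator (subst (λ bit → _ ∈ row SH bit) (sym ([]=⇒lookup a∈)) ∈⊤)

∣p++q∣≡∣p∣+∣q∣ : ∀ {m n} (p : Subset m) (q : Subset n) → ∣ p ++ q ∣ ≡ ∣ p ∣ + ∣ q ∣
∣p++q∣≡∣p∣+∣q∣ [] q = refl
∣p++q∣≡∣p∣+∣q∣ (true ∷ p) q = cong suc (∣p++q∣≡∣p∣+∣q∣ p q)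
∣p++q∣≡∣p∣+∣q∣ (false ∷ p) q = ∣p++q∣≡∣p∣+∣q∣ p q

-- Inclusion–exclusion for (V(G) × SH) ∪ (SG × V(H)), stated without subtraction.
∣⊠-generator∣ : ∀ {n₁ n₂} (SG : Subset n₁) (SH : Subset n₂) →
  ∣ ⊠-generator SG SH ∣ + ∣ SG ∣ * ∣ SH ∣ ≡ n₁ * ∣ SH ∣ + ∣ SG ∣ * n₂
∣⊠-generator∣ [] SH = refl
∣⊠-generator∣ {suc n₁} {n₂} (true ∷ SG) SH = begin
  ∣ ⊤ {n₂} ++ S ∣ + (m + k * m)    ≡⟨ cong (_+ (m + k * m)) (∣p++q∣≡∣p∣+∣q∣ (⊤ {n₂}) S) ⟩
  ∣ ⊤ {n₂} ∣ + ∣ S ∣ + (m + k * m) ≡⟨ cong (λ t → t + ∣ S ∣ + (m + k * m)) (∣⊤∣≡n n₂) ⟩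
  n₂ + ∣ S ∣ + (m + k * m)         ≡⟨ shuffle n₂ ∣ S ∣ m (k * m) ⟩
  m + n₂ + (∣ S ∣ + k * m)         ≡⟨ cong (m + n₂ +_) (∣⊠-generator∣ SG SH) ⟩
  m + n₂ + (n₁ * m + k * n₂)       ≡⟨ interchange m n₂ (n₁ * m) (k * n₂) ⟩
  m + n₁ * m + (n₂ + k * n₂)       ∎
  where
  open ≡-Reasoning
  S = ⊠-generator SG SH
  m = ∣ SH ∣
  k = ∣ SG ∣
  shuffle : ∀ a b c d → a + b + (c + d) ≡ c + a + (b + d)
  shuffle = solve-∀
  interchange : ∀ a b c d → a + b + (c + d) ≡ a + c + (b + d)
  interchange = solve-∀
∣⊠-generator∣ {suc n₁} {n₂} (false ∷ SG) SH = begin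
  ∣ SH ++ S ∣ + k * m          ≡⟨ cong (_+ k * m) (∣p++q∣≡∣p∣+∣q∣ SH S) ⟩
  m + ∣ S ∣ + k * m            ≡⟨ +-assoc m ∣ S ∣ (k * m) ⟩
  m + (∣ S ∣ + k * m)          ≡⟨ cong (m +_) (∣⊠-generator∣ SG SH) ⟩
  m + (n₁ * m + k * n₂)        ≡⟨ +-assoc m (n₁ * m) (k * n₂) ⟨
  m + n₁ * m + k * n₂          ∎
  where
  open ≡-Reasoning
  S = ⊠-generator SG SH
  m = ∣ SH ∣
  k = ∣ SG ∣

⊔-separates : ∀ {α β} → α ≢ β → ∀ γ γ′ → α ≢ γ ⊔ β ⊎ γ′ ⊔ α ≢ β
⊔-separates {α} {β} α≢β γ γ′ with α ≟ γ ⊔ β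
... | no α≢γ⊔β = inj₁ α≢γ⊔β
... | yes α≡γ⊔β = inj₂ λ γ′⊔α≡β → <⇒≢ (<-≤-trans β<α (m≤n⊔m γ′ α)) (sym γ′⊔α≡β)
  where
  β<α : β < α
  β<α = ≤∧≢⇒< (≤-trans (m≤n⊔m γ β) (≤-reflexive (sym α≡γ⊔β))) (≢-sym α≢β)

module _ {G H : Graph} (distG : ∀ x y → ∃ (Dist G x y))
         {SG : Subset (order G)} {SH : Subset (order H)}
         (genG : IsMetricGenerator G SG) (genH : IsMetricGenerator H SH) where

  -- If b ≠ d, some s ∈ SH separates b from d, and then (a , s) or (c , s) separates the two
  -- vertices; if b = d, the vertex (g , b) does for any g ∈ SG separating a from c.
  ⊠-generator-distinguishes : ∀ a b c d → combine a b ≢ combine c d →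
    ∃ λ v → v ∈ ⊠-generator SG SH × Distinguishes (G ⊠ H) v (combine a b) (combine c d)
  ⊠-generator-distinguishes a b c d ab≢cd with b ≟ᶠ d
  ... | no b≢d with genH b d b≢d
  ...   | s , s∈ , α , β , dα , dβ , α≢β with distG a c | distG c a
  ...     | γ , dγ | γ′ , dγ′ with ⊔-separates α≢β γ γ′
  ...       | inj₁ ne = combine a s , column-⊆-⊠-generator SG SH s∈ ,
                α , γ ⊔ β , Dist-⊠ (Dist-refl a) dα , Dist-⊠ dγ dβ , ne
  ...       | inj₂ ne = combine c s , column-⊆-⊠-generator SG SH s∈ ,
                γ′ ⊔ α , β , Dist-⊠ dγ′ dα , Dist-⊠ (Dist-refl c) dβ , ne
  ⊠-generator-distinguishes a b c d ab≢cd | yes refl with a ≟ᶠ c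
  ... | yes refl = contradiction refl ab≢cd
  ... | no a≢c with genG a c a≢c
  ...   | g , g∈ , α , β , dα , dβ , α≢β = combine g b , row-⊆-⊠-generator SG SH g∈ ,
            α ⊔ 0 , β ⊔ 0 , Dist-⊠ dα (Dist-refl b) , Dist-⊠ dβ (Dist-refl b) ,
            subst₂ _≢_ (sym (⊔-identityʳ α)) (sym (⊔-identityʳ β)) α≢β

  ⊠-isMetricGenerator : IsMetricGenerator (G ⊠ H) (⊠-generator SG SH)
  ⊠-isMetricGenerator p q p≢q = subst₂ Separated (combine∘remQuot p) (combine∘remQuot q)
    (⊠-generator-distinguishes a b c d λ ab≡cd →
      p≢q (trans (sym (combine∘remQuot p)) (trans ab≡cd (combine∘remQuot q))))
    where
    combine∘remQuot : ∀ r → uncurry combine (remQuot {order G} (order H) r) ≡ r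
    combine∘remQuot = combine-remQuot {order G} (order H)
    Separated : Fin (order G * order H) → Fin (order G * order H) → Set
    Separated x y = ∃ λ v → v ∈ ⊠-generator SG SH × Distinguishes (G ⊠ H) v x y
    a = proj₁ (remQuot {order G} (order H) p)
    b = proj₂ (remQuot {order G} (order H) p)
    c = proj₁ (remQuot {order G} (order H) q)
    d = proj₂ (remQuot {order G} (order H) q)

theorem1 : (G H : Graph) → Connected G → Connected H → order G ≥ 2 →
    (dG dH dGH : ℕ) → IsMetricDim G dG → IsMetricDim H dH → IsMetricDim (G ⊠ H) dGH →
    dGH + dG * dH ≤ order G * dH + order H * dG
theorem1 G H cG _ _ _ _ dGH ((SG , genG , refl) , _) ((SH , genH , refl) , _) (_ , minimal) =
  decidable-stable (_ ≤? _) do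
    distG ← ¬¬-Dist G cG
    return (begin
      dGH + ∣ SG ∣ * ∣ SH ∣
        ≤⟨ +-monoˡ-≤ _ (minimal _ (⊠-isMetricGenerator distG genG genH)) ⟩
      ∣ ⊠-generator SG SH ∣ + ∣ SG ∣ * ∣ SH ∣
        ≡⟨ ∣⊠-generator∣ SG SH ⟩
      order G * ∣ SH ∣ + ∣ SG ∣ * order H
        ≡⟨ cong (order G * ∣ SH ∣ +_) (*-comm ∣ SG ∣ (order H)) ⟩
      order G * ∣ SH ∣ + order H * ∣ SG ∣ ∎)
  where open ≤-Reasoning
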